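{- Let $W_n$ be the group of signed permutations of $\{\pm1,\dots,\pm n\}$ and let $H \le W_n$ be a subgroup such that (1) the natural projection $H \to S_n$ is surjective, and (2) $H$ contains a $2$-cycle (as a permutation of the $2n$ letters $\{\pm1,\dots,\pm n\}$). Then $H = W_n$.
   Context: $W_n$ is the group of permutations $\pi$ of $\{\pm1,\dots,\pm n\}$ satisfying $\pi(-k) = -\pi(k)$ for all $k$; it is isomorphic to $(\mathbb{Z}/2\mathbb{Z})^n \rtimes S_n$, and the natural projection $W_n \to S_n$ sends $\pi$ to the permutation $k \mapsto |\pi(k)|$ of $\{1,\dots,n\}$. -}

module Defs where

open import Data.Nat using (ℕ)
open import Data.Fin using (Fin)
open import Data.Sign using (Sign; opposite) renaming (+ to ⊕)
open import Data.Product using (_×_; _,_; proj₂; Σ; ∃; ∃-syntax)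
open import Data.Fin.Permutation using (Permutation′; _⟨$⟩ʳ_)
open import Function.Bundles using (_↔_; Inverse)
open import Function.Construct.Identity using (↔-id)
open import Function.Construct.Composition using (_↔-∘_)
open import Function.Construct.Symmetry using (↔-sym)
open import Relation.Binary.PropositionalEquality using (_≡_; _≢_)

-- The 2n letters ±1,…,±n : a letter is a sign together with an index k ∈ {1..n}
-- (encoded as Fin n).  (s , k) stands for s·k.
Letter : ℕ → Set
Letter n = Sign × Fin n

neg : ∀ {n} → Letter n → Letter n
neg (s , k) = opposite s , k

∣_∣ₗ : ∀ {n} → Letter n → Fin n
∣ (s , k) ∣ₗ = k

Perm : ℕ → Set
Perm n = Letter n ↔ Letter n

app : ∀ {n} → Perm n → Letter n → Letter n
app π = Inverse.to π

-- π ∈ W_n : π(-x) = -π(x)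
IsSigned : ∀ {n} → Perm n → Set
IsSigned π = ∀ x → app π (neg x) ≡ neg (app π x)

-- a subgroup H ≤ W_n, given as a predicate on permutations of the letters
-- (respecting pointwise equality of permutations)
record IsSubgroupW (n : ℕ) (H : Perm n → Set) : Set where
  field
    resp   : ∀ π ρ → (∀ x → app π x ≡ app ρ x) → H π → H ρ
    signed : ∀ π → H π → IsSigned π
    one    : H (↔-id (Letter n))
    mul    : ∀ π ρ → H π → H ρ → H (π ↔-∘ ρ)
    inv    : ∀ π → H π → H (↔-sym π)

ProjSurjective : ∀ n → (Perm n → Set) → Set
ProjSurjective n H =
  (σ : Permutation′ n) → ∃[ π ] (H π × (∀ k → ∣ app π (⊕ , k) ∣ₗ ≡ σ ⟨$⟩ʳ k))

IsTwoCycle : ∀ {n} → Perm n → Set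
IsTwoCycle {n} π = ∃[ a ] ∃[ b ] (a ≢ b × app π a ≡ b × app π b ≡ a ×
  (∀ x → x ≢ a → x ≢ b → app π x ≡ x))

ContainsTwoCycle : ∀ n → (Perm n → Set) → Set
ContainsTwoCycle n H = ∃[ π ] (H π × IsTwoCycle π)

-- A 2-cycle of the 2n letters that commutes with x ↦ −x must swap some k and −k, so it
-- is the sign change at k. Conjugating it by an element of H lying over the transposition
-- (j k) gives the sign change at j, and these generate all sign changes (ℤ/2ℤ)ⁿ ⊆ H.
-- Finally every π ∈ Wₙ is ρ · (sign change) for any ρ ∈ H over the same element of Sₙ.
module Submission where

open import Defs
open import Data.Nat using (ℕ)
open import Data.Fin using (Fin; _≟_)
open import Data.Fin.Permutation using (Permutation′; _⟨$⟩ʳ_; _⟨$⟩ˡ_; transpose; inverseˡ)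
open import Data.Sign using (Sign; _*_) renaming (+ to ⊕; - to ⊖)
open import Data.Sign.Properties
  using (opposite-involutive; s≢opposite[s]; s*s≡+; *-assoc; *-comm; *-identityʳ)
  renaming (_≟_ to _≟ₛ_)
open import Data.Bool using (if_then_else_)
open import Data.List using (List; []; _∷_; allFin)
open import Data.List.Relation.Unary.Any using (here; there)
open import Data.List.Membership.Propositional using (_∈_)
open import Data.List.Membership.Propositional.Properties using (∈-allFin)
open import Data.Vec.Functional using (zipWith)
open import Data.Product using (_×_; _,_; proj₁; ∃-syntax)
open import Data.Product.Properties using (≡-dec)
open import Data.Sum using (_⊎_; inj₁; inj₂)
open import Function using (_∘_)
open import Function.Bundles using (Inverse; mk↔ₛ′)
open import Function.Construct.Identity using (↔-id)
open import Function.Construct.Composition using (_↔-∘_)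
open import Function.Construct.Symmetry using (↔-sym)
open import Relation.Nullary using (yes; no; does; contradiction)
open import Relation.Nullary.Decidable using (dec-true; dec-false)
open import Relation.Binary.PropositionalEquality
  using (_≡_; _≢_; refl; sym; trans; cong; cong₂; _≗_; module ≡-Reasoning)

module _ {n : ℕ} where

  infix 4 _≈_
  _≈_ : Perm n → Perm n → Set
  π ≈ ρ = ∀ x → app π x ≡ app ρ x

  neg-involutive : (x : Letter n) → neg (neg x) ≡ x
  neg-involutive (s , i) = cong (_, i) (opposite-involutive s)

  neg≢ : (x : Letter n) → neg x ≢ x
  neg≢ (s , i) eq = s≢opposite[s] s (sym (cong proj₁ eq))

  ∣∣-≡⇒≡⊎≡neg : (x y : Letter n) → ∣ x ∣ₗ ≡ ∣ y ∣ₗ → y ≡ x ⊎ y ≡ neg x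
  ∣∣-≡⇒≡⊎≡neg (⊕ , i) (⊕ , .i) refl = inj₁ refl
  ∣∣-≡⇒≡⊎≡neg (⊕ , i) (⊖ , .i) refl = inj₂ refl
  ∣∣-≡⇒≡⊎≡neg (⊖ , i) (⊕ , .i) refl = inj₂ refl
  ∣∣-≡⇒≡⊎≡neg (⊖ , i) (⊖ , .i) refl = inj₁ refl

  flipSigns : (Fin n → Sign) → Letter n → Letter n
  flipSigns e (s , i) = e i * s , i

  flipSigns-involutive : ∀ e x → flipSigns e (flipSigns e x) ≡ x
  flipSigns-involutive e (s , i) = cong (_, i) (begin
    e i * (e i * s)  ≡⟨ *-assoc (e i) (e i) s ⟨
    e i * e i * s    ≡⟨ cong (_* s) (s*s≡+ (e i)) ⟩
    s                ∎)
    where open ≡-Reasoning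

  signChange : (Fin n → Sign) → Perm n
  signChange e =
    mk↔ₛ′ (flipSigns e) (flipSigns e) (flipSigns-involutive e) (flipSigns-involutive e)

  flipSigns-⊕ : ∀ e x → e ∣ x ∣ₗ ≡ ⊕ → flipSigns e x ≡ x
  flipSigns-⊕ e (s , i) eq rewrite eq = refl

  flipSigns-⊖ : ∀ e x → e ∣ x ∣ₗ ≡ ⊖ → flipSigns e x ≡ neg x
  flipSigns-⊖ e (s , i) eq rewrite eq = refl

  flipSigns-cong : ∀ {e e′} → e ≗ e′ → ∀ x → flipSigns e x ≡ flipSigns e′ x
  flipSigns-cong e≗e′ (s , i) = cong (λ u → u * s , i) (e≗e′ i)

  flipSigns-zipWith : ∀ d e x → flipSigns d (flipSigns (zipWith _*_ d e) x) ≡ flipSigns e x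
  flipSigns-zipWith d e (s , i) = cong (_, i) (begin
    d i * (d i * e i * s)  ≡⟨ cong (d i *_) (*-assoc (d i) (e i) s) ⟩
    d i * (d i * (e i * s)) ≡⟨ *-assoc (d i) (d i) (e i * s) ⟨
    d i * d i * (e i * s)   ≡⟨ cong (_* (e i * s)) (s*s≡+ (d i)) ⟩
    e i * s                 ∎)
    where open ≡-Reasoning

  negativeAt : Fin n → Fin n → Sign
  negativeAt j i = if does (i ≟ j) then ⊖ else ⊕

  negativeAt-≡ : ∀ j → negativeAt j j ≡ ⊖
  negativeAt-≡ j rewrite dec-true (j ≟ j) refl = refl

  negativeAt-≢ : ∀ {i j} → i ≢ j → negativeAt j i ≡ ⊕
  negativeAt-≢ {i} {j} i≢j rewrite dec-false (i ≟ j) i≢j = refl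

  negativeAt-∘ : ∀ (σ : Permutation′ n) {j k} → σ ⟨$⟩ʳ j ≡ k →
    ∀ i → negativeAt k (σ ⟨$⟩ʳ i) ≡ negativeAt j i
  negativeAt-∘ σ {j} {k} σj≡k i with i ≟ j
  ... | yes refl rewrite σj≡k = negativeAt-≡ k
  ... | no i≢j = negativeAt-≢ σi≢k
    where
    σi≢k : σ ⟨$⟩ʳ i ≢ k
    σi≢k σi≡k = i≢j (begin
      i                    ≡⟨ inverseˡ σ ⟨
      σ ⟨$⟩ˡ (σ ⟨$⟩ʳ i)     ≡⟨ cong (σ ⟨$⟩ˡ_) (trans σi≡k (sym σj≡k)) ⟩
      σ ⟨$⟩ˡ (σ ⟨$⟩ʳ j)     ≡⟨ inverseˡ σ ⟩
      j                    ∎)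
      where open ≡-Reasoning

  transpose-≡ : (j k : Fin n) → transpose j k ⟨$⟩ʳ j ≡ k
  transpose-≡ j k rewrite dec-true (j ≟ j) refl = refl

  ∣_∣ₚ : Perm n → Fin n → Fin n
  ∣ π ∣ₚ i = ∣ app π (⊕ , i) ∣ₗ

  sym-signed : ∀ (π : Perm n) → IsSigned π → IsSigned (↔-sym π)
  sym-signed π sπ y = begin
    from (neg y)                 ≡⟨ cong (from ∘ neg) (Inverse.strictlyInverseˡ π y) ⟨
    from (neg (to (from y)))     ≡⟨ cong from (sπ (from y)) ⟨
    from (to (neg (from y)))     ≡⟨ Inverse.strictlyInverseʳ π _ ⟩
    neg (from y)                 ∎
    where
    open ≡-Reasoning
    open Inverse π using (to; from)

  ∘-signed : ∀ (π ρ : Perm n) → IsSigned π → IsSigned ρ → IsSigned (π ↔-∘ ρ)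
  ∘-signed π ρ sπ sρ x = trans (cong (app π) (sρ x)) (sπ (app ρ x))

  ∣app∣ : ∀ (π : Perm n) → IsSigned π → ∀ x → ∣ app π x ∣ₗ ≡ ∣ π ∣ₚ ∣ x ∣ₗ
  ∣app∣ π sπ (⊕ , i) = refl
  ∣app∣ π sπ (⊖ , i) = cong ∣_∣ₗ (sπ (⊕ , i))

  ∣∣ₚ-inverse : ∀ (π : Perm n) → IsSigned π → ∀ i → ∣ ↔-sym π ∣ₚ (∣ π ∣ₚ i) ≡ i
  ∣∣ₚ-inverse π sπ i =
    trans (sym (∣app∣ (↔-sym π) (sym-signed π sπ) (app π (⊕ , i))))
          (cong ∣_∣ₗ (Inverse.strictlyInverseʳ π (⊕ , i)))

  projection : (π : Perm n) → IsSigned π → Permutation′ n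
  projection π sπ = mk↔ₛ′ ∣ π ∣ₚ ∣ ↔-sym π ∣ₚ
    (∣∣ₚ-inverse (↔-sym π) (sym-signed π sπ)) (∣∣ₚ-inverse π sπ)

  signed-∣∣ₚ-id⇒signChange : ∀ (f : Perm n) → IsSigned f → (∀ i → ∣ f ∣ₚ i ≡ i) →
    f ≈ signChange (λ i → proj₁ (app f (⊕ , i)))
  signed-∣∣ₚ-id⇒signChange f sf fix (⊕ , i) =
    cong₂ _,_ (sym (*-identityʳ (proj₁ (app f (⊕ , i))))) (fix i)
  signed-∣∣ₚ-id⇒signChange f sf fix (⊖ , i) =
    trans (sf (⊕ , i)) (cong₂ _,_ (*-comm ⊖ (proj₁ (app f (⊕ , i)))) (fix i))

  conj-signChange : ∀ (ρ : Perm n) → IsSigned ρ → ∀ e →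
    ↔-sym ρ ↔-∘ (signChange e ↔-∘ ρ) ≈ signChange (e ∘ ∣ ρ ∣ₚ)
  -- The `with` also reduces the right-hand side flipSigns (e ∘ ∣ ρ ∣ₚ) x to x, resp. neg x.
  conj-signChange ρ sρ e x with e (∣ ρ ∣ₚ ∣ x ∣ₗ) in eq
  ... | ⊕ = begin
    from (flipSigns e (to x))  ≡⟨ cong from (flipSigns-⊕ e (to x) e∣to-x∣≡) ⟩
    from (to x)                ≡⟨ Inverse.strictlyInverseʳ ρ x ⟩
    x                          ∎
    where
    open ≡-Reasoning
    open Inverse ρ using (to; from)
    e∣to-x∣≡ : e ∣ to x ∣ₗ ≡ ⊕
    e∣to-x∣≡ = trans (cong e (∣app∣ ρ sρ x)) eq
  ... | ⊖ = begin
    from (flipSigns e (to x))  ≡⟨ cong from (flipSigns-⊖ e (to x) e∣to-x∣≡) ⟩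
    from (neg (to x))          ≡⟨ cong from (sρ x) ⟨
    from (to (neg x))          ≡⟨ Inverse.strictlyInverseʳ ρ (neg x) ⟩
    neg x                      ∎
    where
    open ≡-Reasoning
    open Inverse ρ using (to; from)
    e∣to-x∣≡ : e ∣ to x ∣ₗ ≡ ⊖
    e∣to-x∣≡ = trans (cong e (∣app∣ ρ sρ x)) eq

  signedTwoCycle⇒signChange : ∀ (t : Perm n) → IsSigned t → IsTwoCycle t →
    ∃[ k ] t ≈ signChange (negativeAt k)
  signedTwoCycle⇒signChange t st (a , b , a≢b , ta≡b , _ , fix) = ∣ a ∣ₗ , t≈
    where
    b≡neg-a : b ≡ neg a
    b≡neg-a with ≡-dec _≟ₛ_ _≟_ (neg a) b
    ... | yes neg-a≡b = sym neg-a≡b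
    ... | no neg-a≢b = contradiction a≡b a≢b
      where
      neg-a≡neg-b : neg a ≡ neg b
      neg-a≡neg-b = trans (sym (fix (neg a) (neg≢ a) neg-a≢b)) (trans (st a) (cong neg ta≡b))
      a≡b : a ≡ b
      a≡b = trans (sym (neg-involutive a)) (trans (cong neg neg-a≡neg-b) (neg-involutive b))

    t-neg : ∀ x → ∣ x ∣ₗ ≡ ∣ a ∣ₗ → app t x ≡ neg x
    t-neg x ∣x∣≡∣a∣ with ∣∣-≡⇒≡⊎≡neg a x (sym ∣x∣≡∣a∣)
    ... | inj₁ refl = trans ta≡b b≡neg-a
    ... | inj₂ refl = trans (st a) (cong neg (trans ta≡b b≡neg-a))

    t≈ : t ≈ signChange (negativeAt ∣ a ∣ₗ)
    -- The `with` also decides negativeAt ∣ a ∣ₗ ∣ x ∣ₗ on the right-hand side.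
    t≈ x with ∣ x ∣ₗ ≟ ∣ a ∣ₗ
    ... | yes ∣x∣≡∣a∣ = t-neg x ∣x∣≡∣a∣
    ... | no ∣x∣≢∣a∣ =
      fix x (∣x∣≢∣a∣ ∘ cong ∣_∣ₗ) (∣x∣≢∣a∣ ∘ cong ∣_∣ₗ ∘ λ x≡b → trans x≡b b≡neg-a)

module _ {n : ℕ} {H : Perm n → Set} (G : IsSubgroupW n H) where
  open IsSubgroupW G

  signChange-∈-supportedIn : (∀ j → H (signChange (negativeAt j))) →
    ∀ (xs : List (Fin n)) e → (∀ i → e i ≡ ⊖ → i ∈ xs) → H (signChange e)
  signChange-∈-supportedIn _ [] e supp = resp (↔-id _) (signChange e) id≈ one
    where
    e≡⊕ : ∀ i → e i ≡ ⊕
    e≡⊕ i with e i in eq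
    ... | ⊕ = refl
    ... | ⊖ with () ← supp i eq
    id≈ : ↔-id _ ≈ signChange e
    id≈ x = sym (flipSigns-⊕ e x (e≡⊕ ∣ x ∣ₗ))
  signChange-∈-supportedIn flips (j ∷ xs) e supp with e j in ej
  ... | ⊕ = signChange-∈-supportedIn flips xs e supp′
    where
    supp′ : ∀ i → e i ≡ ⊖ → i ∈ xs
    supp′ i ei with supp i ei
    ... | here refl with () ← trans (sym ej) ei
    ... | there i∈xs = i∈xs
  ... | ⊖ = resp _ (signChange e) (flipSigns-zipWith (negativeAt j) e)
    (mul _ _ (flips j) (signChange-∈-supportedIn flips xs e′ supp′))
    where
    e′ : Fin n → Sign
    e′ = zipWith _*_ (negativeAt j) e
    supp′ : ∀ i → e′ i ≡ ⊖ → i ∈ xs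
    supp′ i e′i with i ≟ j | supp i
    ... | yes refl | _ rewrite ej with () ← e′i
    ... | no i≢j | supp-i with supp-i e′i
    ...   | here i≡j = contradiction i≡j i≢j
    ...   | there i∈xs = i∈xs

  signChange-∈ : (∀ j → H (signChange (negativeAt j))) → ∀ e → H (signChange e)
  signChange-∈ flips e = signChange-∈-supportedIn flips (allFin n) e (λ i _ → ∈-allFin i)

  negativeAt-∈ : ProjSurjective n H → ∀ k → H (signChange (negativeAt k)) →
    ∀ j → H (signChange (negativeAt j))
  negativeAt-∈ surj k Hk j with surj (transpose j k)
  ... | ρ , Hρ , ∣ρ∣≡σ = resp _ _ conj≈ (mul _ _ (inv ρ Hρ) (mul _ _ Hk Hρ))
    where
    negativeAt-k∘∣ρ∣ : negativeAt k ∘ ∣ ρ ∣ₚ ≗ negativeAt j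
    negativeAt-k∘∣ρ∣ i = trans (cong (negativeAt k) (∣ρ∣≡σ i))
      (negativeAt-∘ (transpose j k) (transpose-≡ j k) i)
    conj≈ : ↔-sym ρ ↔-∘ (signChange (negativeAt k) ↔-∘ ρ) ≈ signChange (negativeAt j)
    conj≈ x = trans (conj-signChange ρ (signed ρ Hρ) (negativeAt k) x)
      (flipSigns-cong negativeAt-k∘∣ρ∣ x)

  signed-lift : ProjSurjective n H → ∀ π → IsSigned π →
    ∃[ ρ ] ∃[ e ] (H ρ × π ≈ ρ ↔-∘ signChange e)
  signed-lift surj π sπ with surj (projection π sπ)
  ... | ρ , Hρ , ∣ρ∣≡∣π∣ = ρ , e , Hρ , π≈
    where
    open ≡-Reasoning
    sρ⁻¹ : IsSigned (↔-sym ρ)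
    sρ⁻¹ = sym-signed ρ (signed ρ Hρ)
    f : Perm n
    f = ↔-sym ρ ↔-∘ π
    e : Fin n → Sign
    e i = proj₁ (app f (⊕ , i))

    ∣f∣ₚ≡id : ∀ i → ∣ f ∣ₚ i ≡ i
    ∣f∣ₚ≡id i = begin
      ∣ app (↔-sym ρ) (app π (⊕ , i)) ∣ₗ  ≡⟨ ∣app∣ (↔-sym ρ) sρ⁻¹ (app π (⊕ , i)) ⟩
      ∣ ↔-sym ρ ∣ₚ (∣ π ∣ₚ i)             ≡⟨ cong ∣ ↔-sym ρ ∣ₚ (∣ρ∣≡∣π∣ i) ⟨
      ∣ ↔-sym ρ ∣ₚ (∣ ρ ∣ₚ i)             ≡⟨ ∣∣ₚ-inverse ρ (signed ρ Hρ) i ⟩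
      i                                   ∎

    π≈ : π ≈ ρ ↔-∘ signChange e
    π≈ x = begin
      app π x              ≡⟨ Inverse.strictlyInverseˡ ρ (app π x) ⟨
      app ρ (app f x)      ≡⟨ cong (app ρ) (signed-∣∣ₚ-id⇒signChange f sf ∣f∣ₚ≡id x) ⟩
      app ρ (flipSigns e x) ∎
      where
      sf : IsSigned f
      sf = ∘-signed (↔-sym ρ) π sρ⁻¹ sπ

mainTheorem16 : (n : ℕ) (H : Perm n → Set) → IsSubgroupW n H →
    ProjSurjective n H → ContainsTwoCycle n H →
    (π : Perm n) → IsSigned π → H π
mainTheorem16 n H G surj (t , Ht , t-twoCycle) π sπ =
  let open IsSubgroupW G
      k , t≈ = signedTwoCycle⇒signChange t (signed t Ht) t-twoCycle
      ρ , e , Hρ , π≈ = signed-lift G surj π sπ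
      allNegativeAt = negativeAt-∈ G surj k (resp t _ t≈ Ht)
  in resp _ π (sym ∘ π≈) (mul _ _ Hρ (signChange-∈ G allNegativeAt e))
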